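{- Let $k\ge2$ and $2\le i\le k$ be integers, $\lambda$ a positive integer, and $a_{k,n}^{i}$ the $i$-th sequence of generalized order-$k$ numbers defined in the context. Let $\iota=\sqrt{ -1}$. For $m\ge1$ let $H_{k,m}=(h_{st})$ be the $m\times m$ matrix with $h_{st}=\iota^{s-t}$ if $-1\le s-t<k$ and $s\ne t$, $h_{ss}=\lambda$, and $h_{st}=0$ otherwise. For $n\ge 3$ let $H_{k,n}^{i}$ be the $n\times n$ matrix whose first row is $(1,-\iota,0,\dots,0)$, whose first column has entry $\iota^{r-1}$ in row $r$ for $1\le r\le\min(n,k-i+1)$ and $0$ in the remaining rows, and whose submatrix obtained by deleting the first row and first column is $H_{k,n-1}$. Then $\operatorname{per}(H_{k,n}^{i})=a_{k,n}^{i}$, where $\operatorname{per}$ denotes the permanent.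
   Context: For a positive integer $k$ and a positive integer $\lambda$, the $k$ sequences of generalized order-$k$ numbers are defined as follows: for each $1\le i\le k$, the sequence $(a_{k,n}^{i})_{n\ge 1-k}$ has initial values $a_{k,n}^{i}=1$ if $i=1-n$ and $a_{k,n}^{i}=0$ otherwise, for $1-k\le n\le 0$, and satisfies $a_{k,n}^{i}=\lambda a_{k,n-1}^{i}+a_{k,n-2}^{i}+\cdots+a_{k,n-k}^{i}$ for $n\ge 1$. -}

module Defs where

open import Data.Nat as ℕ using (ℕ; zero; suc; _≤_; _<_; _≤?_; _<?_)
open import Data.Integer as ℤ using (ℤ; +_)
open import Data.Fin using (Fin; zero; suc; toℕ)
open import Data.Fin.Properties using (all?) renaming (_≟_ to _≟ᶠ_)
open import Data.List using (List; []; _∷_; map; concatMap; filter; foldr; take; reverse; upTo)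
open import Relation.Binary.PropositionalEquality using (_≡_)
open import Relation.Nullary using (Dec; yes; no; _→-dec_)

-- Gaussian integers ℤ[ι] ⊂ ℂ (all matrix entries lie here)

infix 5 _+ι_
record GI : Set where
  constructor _+ι_
  field
    re : ℤ
    im : ℤ
open GI public

infixl 6 _⊕_
infixl 7 _⊗_

_⊕_ : GI → GI → GI
(a +ι b) ⊕ (c +ι d) = (a ℤ.+ c) +ι (b ℤ.+ d)

_⊗_ : GI → GI → GI
(a +ι b) ⊗ (c +ι d) = (a ℤ.* c ℤ.- b ℤ.* d) +ι (a ℤ.* d ℤ.+ b ℤ.* c)

0ᴳ 1ᴳ ι -ι : GI
0ᴳ = + 0 +ι + 0
1ᴳ = + 1 +ι + 0
ι  = + 0 +ι + 1
-ι = + 0 +ι ℤ.- (+ 1)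

fromℕᴳ : ℕ → GI
fromℕᴳ n = + n +ι + 0

ι^ : ℕ → GI
ι^ zero    = 1ᴳ
ι^ (suc n) = ι ⊗ ι^ n

-- Permanent: per A = Σ_{σ ∈ S_n} Π_r A r (σ r),
-- where S_n = injective (hence bijective) maps Fin n → Fin n.

allFuns : (m n : ℕ) → List (Fin m → Fin n)
allFuns zero    n = (λ ()) ∷ []
allFuns (suc m) n =
  concatMap (λ f → map (λ j → λ { zero → j ; (suc r) → f r }) (allFin' n)) (allFuns m n)
  where
  allFin' : (n : ℕ) → List (Fin n)
  allFin' zero    = []
  allFin' (suc n) = zero ∷ map suc (allFin' n)

IsPerm : {n : ℕ} → (Fin n → Fin n) → Set
IsPerm σ = ∀ r s → σ r ≡ σ s → r ≡ s

isPerm? : {n : ℕ} (σ : Fin n → Fin n) → Dec (IsPerm σ)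
isPerm? σ = all? (λ r → all? (λ s → (σ r ≟ᶠ σ s) →-dec (r ≟ᶠ s)))

permutations : (n : ℕ) → List (Fin n → Fin n)
permutations n = filter isPerm? (allFuns n n)

prodᴳ : (n : ℕ) → (Fin n → GI) → GI
prodᴳ zero    f = 1ᴳ
prodᴳ (suc n) f = f zero ⊗ prodᴳ n (λ r → f (suc r))

sumᴳ : List GI → GI
sumᴳ = foldr _⊕_ 0ᴳ

per : (n : ℕ) → (Fin n → Fin n → GI) → GI
per n A = sumᴳ (map (λ σ → prodᴳ n (λ r → A r (σ r))) (permutations n))

-- Matrices (indices 0-based: Fin row s ↔ paper row s+1; s - t unchanged)

H : (k lam m : ℕ) → Fin m → Fin m → GI
H k lam m s t with toℕ s ℕ.≟ toℕ t
... | yes _ = fromℕᴳ lam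
... | no _ with suc (toℕ s) ℕ.≟ toℕ t
...   | yes _ = -ι                          -- s - t = -1 : ι^(-1) = -ι
...   | no _ with toℕ t <? toℕ s
...     | no _ = 0ᴳ
...     | yes _ with toℕ s ℕ.∸ toℕ t <? k
...       | yes _ = ι^ (toℕ s ℕ.∸ toℕ t)
...       | no _  = 0ᴳ

-- With 0-based row index r: entry ι^r iff r + 1 ≤ k - i + 1, i.e. r + i ≤ k.
Hi : (k lam i n : ℕ) → Fin n → Fin n → GI
Hi k lam i (suc m) zero zero = 1ᴳ
Hi k lam i (suc m) zero (suc zero) = -ι
Hi k lam i (suc m) zero (suc (suc t)) = 0ᴳ
Hi k lam i (suc m) (suc r) zero with suc (toℕ r) ℕ.+ i ≤? k
... | yes _ = ι^ (suc (toℕ r))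
... | no _  = 0ᴳ
Hi k lam i (suc m) (suc s) (suc t) = H k lam m s t

-- Generalized order-k numbers a^i_{k,n}.
-- history k lam i n = [a_n, a_{n-1}, …, a_{1-k}]  (newest first).
-- Initial values (n = 1-k … 0): a_n = 1 iff i = 1 - n.
-- a_n = lam * a_{n-1} + a_{n-2} + … + a_{n-k}  (n ≥ 1).

initial : (k i : ℕ) → List ℕ
initial k i = map (λ j → if-eq (suc j) i) (upTo k)   -- entry j is a_{-j}; 1 - (-j) = j+1
  where
  if-eq : ℕ → ℕ → ℕ
  if-eq a b with a ℕ.≟ b
  ... | yes _ = 1
  ... | no _  = 0

next : (k lam : ℕ) → List ℕ → ℕ
next k lam []       = 0
next k lam (x ∷ xs) = lam ℕ.* x ℕ.+ foldr ℕ._+_ 0 (take (k ℕ.∸ 1) xs)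

history : (k lam i n : ℕ) → List ℕ
history k lam i zero    = initial k i
history k lam i (suc n) = next k lam (history k lam i n) ∷ history k lam i n

a : (k lam i n : ℕ) → ℕ
a k lam i n with history k lam i n
... | []    = 0
... | x ∷ _ = x

{-# OPTIONS --safe #-}
module Submission where

-- Expanding along the first row, whose entries are (v 0, -ι, 0, …, 0), the permanent of
-- H_{k,m+1} with its first column replaced by v is v 0 · per H_{k,m} - ι · per M, where M has
-- the same shape with column (v 1, v 2, …).  For a column v d = ι^d · c d the powers of ι and
-- of -ι cancel, so the permanent is the convolution Σ_{j ≤ m} c j · per H_{k,m-j}.  The first
-- column of H_{k,m} has c = (λ, 1, …, 1, 0, …) (k - 1 ones), which turns this into the order-k
-- recurrence: per H_{k,m} = a^1_{k,m}.  The first column of H^i_{k,n} has c_j = 1 exactly for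
-- j ≤ k - i, giving Σ_{t ≤ k-i} a^1_{k,n-1-t}, and this equals a^i_{k,n} by telescoping the
-- identity a^i_{n+1} = a^{i+1}_n + a^1_n.

open import Defs
open import Relation.Binary.PropositionalEquality
open import Level using (0ℓ)
open import Algebra.Bundles using (CommutativeSemiring)
open import Algebra.Definitions {A = GI} _≡_
open import Algebra.Structures {A = GI} _≡_
open import Algebra.Structures.Biased {A = GI} _≡_ using (isCommutativeMonoidˡ; isCommutativeSemiringʳ)
open import Data.Bool using (Bool; true; false; if_then_else_; _∧_; not)
open import Data.Bool.Properties using (if-∧)
open import Data.Fin using (Fin; zero; suc; toℕ; punchIn)
open import Data.Fin.Properties using (_≟_; punchIn-injective; punchInᵢ≢i; 0≢1+n)
  renaming (suc-injective to suc-injectiveᶠ)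
import Data.Integer as ℤ
import Data.Integer.Properties as ℤP
open import Data.Integer.Tactic.RingSolver using (solve-∀)
open import Data.List using (List; []; _∷_; map; foldr; filter; concatMap; _++_; take; applyUpTo; upTo)
open import Data.List.Properties using (map-cong; map-∘; map-++)
open import Data.Nat as ℕ using (ℕ; zero; suc; _+_; _*_; _∸_; _≤_; _<_; z≤n; s≤s; z<s; s<s; _≤?_; _<?_)
open import Data.Nat.Induction using (<-rec)
open import Data.Nat.Properties
  using ( +-comm; +-suc; +-identityʳ; *-zeroʳ; *-identityˡ; *-distribˡ-+; +-commutativeSemigroup
        ; suc-injective; ≤-refl; ≤-trans; <-trans; ≤-pred; n<1+n; n≤1+n; m≤n⇒m≤1+n; m≤m+n; m≤n+m
        ; <⇒≤; <⇒≢; <⇒≱; ≤⇒≯; ≮⇒≥; +-monoˡ-≤; ∸-monoˡ-≤; m+[n∸m]≡n; m∸n+n≡m; m∸n≡0⇒m≤n )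
open import Data.Product using (Σ-syntax; _×_; _,_; proj₁)
open import Data.Vec.Functional using () renaming (_∷_ to _∷ᶠ_)
open import Function using (_∘_; _⇔_; mk⇔)
open import Function.Definitions using (Injective)
open import Relation.Binary.Core using (_Preserves_⟶_)
open import Relation.Nullary using (Dec; yes; no; does; ¬_; ¬?; _×-dec_; contradiction)
open import Relation.Nullary.Decidable using (map′; dec-true; dec-false; does-⇔)
open import Algebra.Properties.CommutativeSemigroup +-commutativeSemigroup
  using () renaming (interchange to +-interchange)
open ≡-Reasoning

-- Gaussian integers

⊕-comm : Commutative _⊕_
⊕-comm (a +ι b) (c +ι d) = cong₂ _+ι_ (ℤP.+-comm a c) (ℤP.+-comm b d)

⊕-assoc : Associative _⊕_
⊕-assoc (a +ι b) (c +ι d) (e +ι f) = cong₂ _+ι_ (ℤP.+-assoc a c e) (ℤP.+-assoc b d f)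

⊕-identityˡ : LeftIdentity 0ᴳ _⊕_
⊕-identityˡ (a +ι b) = cong₂ _+ι_ (ℤP.+-identityˡ a) (ℤP.+-identityˡ b)

⊗-comm : Commutative _⊗_
⊗-comm (a +ι b) (c +ι d) = cong₂ _+ι_ (on-re a b c d) (on-im a b c d)
  where
  on-re : ∀ a b c d → a ℤ.* c ℤ.- b ℤ.* d ≡ c ℤ.* a ℤ.- d ℤ.* b
  on-re = solve-∀
  on-im : ∀ a b c d → a ℤ.* d ℤ.+ b ℤ.* c ≡ c ℤ.* b ℤ.+ d ℤ.* a
  on-im = solve-∀

⊗-assoc : Associative _⊗_
⊗-assoc (a +ι b) (c +ι d) (e +ι f) = cong₂ _+ι_ (on-re a b c d e f) (on-im a b c d e f)
  where
  on-re : ∀ a b c d e f → (a ℤ.* c ℤ.- b ℤ.* d) ℤ.* e ℤ.- (a ℤ.* d ℤ.+ b ℤ.* c) ℤ.* f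
                     ≡ a ℤ.* (c ℤ.* e ℤ.- d ℤ.* f) ℤ.- b ℤ.* (c ℤ.* f ℤ.+ d ℤ.* e)
  on-re = solve-∀
  on-im : ∀ a b c d e f → (a ℤ.* c ℤ.- b ℤ.* d) ℤ.* f ℤ.+ (a ℤ.* d ℤ.+ b ℤ.* c) ℤ.* e
                     ≡ a ℤ.* (c ℤ.* f ℤ.+ d ℤ.* e) ℤ.+ b ℤ.* (c ℤ.* e ℤ.- d ℤ.* f)
  on-im = solve-∀

⊗-identityˡ : LeftIdentity 1ᴳ _⊗_
⊗-identityˡ (a +ι b) = cong₂ _+ι_ (on-re a b) (on-im a b)
  where
  open ℤ using (+_)
  on-re : ∀ a b → + 1 ℤ.* a ℤ.- + 0 ℤ.* b ≡ a
  on-re = solve-∀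
  on-im : ∀ a b → + 1 ℤ.* b ℤ.+ + 0 ℤ.* a ≡ b
  on-im = solve-∀

⊗-zeroʳ : RightZero 0ᴳ _⊗_
⊗-zeroʳ (a +ι b) = cong₂ _+ι_ (on-re a b) (on-im a b)
  where
  open ℤ using (+_)
  on-re : ∀ a b → a ℤ.* + 0 ℤ.- b ℤ.* + 0 ≡ + 0
  on-re = solve-∀
  on-im : ∀ a b → a ℤ.* + 0 ℤ.+ b ℤ.* + 0 ≡ + 0
  on-im = solve-∀

⊗-distribˡ-⊕ : _⊗_ DistributesOverˡ _⊕_
⊗-distribˡ-⊕ (a +ι b) (c +ι d) (e +ι f) = cong₂ _+ι_ (on-re a b c d e f) (on-im a b c d e f)
  where
  on-re : ∀ a b c d e f → a ℤ.* (c ℤ.+ e) ℤ.- b ℤ.* (d ℤ.+ f) ≡ (a ℤ.* c ℤ.- b ℤ.* d) ℤ.+ (a ℤ.* e ℤ.- b ℤ.* f)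
  on-re = solve-∀
  on-im : ∀ a b c d e f → a ℤ.* (d ℤ.+ f) ℤ.+ b ℤ.* (c ℤ.+ e) ≡ (a ℤ.* d ℤ.+ b ℤ.* c) ℤ.+ (a ℤ.* f ℤ.+ b ℤ.* e)
  on-im = solve-∀

isCommutativeMonoid : ∀ _∙_ ε → Associative _∙_ → LeftIdentity ε _∙_ → Commutative _∙_ →
                      IsCommutativeMonoid _∙_ ε
isCommutativeMonoid _∙_ ε assoc identityˡ comm = isCommutativeMonoidˡ record
  { isSemigroup = record { isMagma = record { isEquivalence = isEquivalence ; ∙-cong = cong₂ _∙_ } ; assoc = assoc }
  ; identityˡ   = identityˡ
  ; comm        = comm
  }

GI-commutativeSemiring : CommutativeSemiring 0ℓ 0ℓ
GI-commutativeSemiring = record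
  { isCommutativeSemiring = isCommutativeSemiringʳ record
    { +-isCommutativeMonoid = isCommutativeMonoid _⊕_ 0ᴳ ⊕-assoc ⊕-identityˡ ⊕-comm
    ; *-isCommutativeMonoid = isCommutativeMonoid _⊗_ 1ᴳ ⊗-assoc ⊗-identityˡ ⊗-comm
    ; distribˡ              = ⊗-distribˡ-⊕
    ; zeroʳ                 = ⊗-zeroʳ
    }
  }

fromℕᴳ-+ : ∀ m n → fromℕᴳ (m + n) ≡ fromℕᴳ m ⊕ fromℕᴳ n
fromℕᴳ-+ m n = cong (_+ι ℤ.0ℤ) (ℤP.pos-+ m n)

fromℕᴳ-* : ∀ m n → fromℕᴳ (m * n) ≡ fromℕᴳ m ⊗ fromℕᴳ n
fromℕᴳ-* m n = cong₂ _+ι_ (trans (ℤP.pos-* m n) (sym (on-re (ℤ.+ m) (ℤ.+ n)))) (sym (on-im (ℤ.+ m) (ℤ.+ n)))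
  where
  open ℤ using (+_)
  on-re : ∀ x y → x ℤ.* y ℤ.- + 0 ℤ.* + 0 ≡ x ℤ.* y
  on-re = solve-∀
  on-im : ∀ x y → x ℤ.* + 0 ℤ.+ + 0 ℤ.* y ≡ + 0
  on-im = solve-∀

-ι⊗ι≡1ᴳ : -ι ⊗ ι ≡ 1ᴳ
-ι⊗ι≡1ᴳ = refl

open import Algebra.Properties.Semiring.Sum (CommutativeSemiring.semiring GI-commutativeSemiring)
  using (sum; sum-syntax; sum-cong-≗; sum-replicate-zero; sum-remove; ∑-comm; *-distribˡ-sum)
open CommutativeSemiring GI-commutativeSemiring
  using () renaming (+-identityʳ to ⊕-identityʳ; *-identityʳ to ⊗-identityʳ; zeroˡ to ⊗-zeroˡ)
open import Algebra.Properties.CommutativeSemigroup (CommutativeSemiring.*-commutativeSemigroup GI-commutativeSemiring)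
  using () renaming (x∙yz≈y∙xz to ⊗-left-comm)

-ι-cancel : ∀ α z → -ι ⊗ ((α ⊗ ι) ⊗ z) ≡ α ⊗ z
-ι-cancel α z = begin
  -ι ⊗ ((α ⊗ ι) ⊗ z)   ≡⟨ cong (-ι ⊗_) (⊗-assoc α ι z) ⟩
  -ι ⊗ (α ⊗ (ι ⊗ z))   ≡⟨ ⊗-left-comm -ι α _ ⟩
  α ⊗ (-ι ⊗ (ι ⊗ z))   ≡⟨ cong (α ⊗_) (sym (⊗-assoc -ι ι z)) ⟩
  α ⊗ ((-ι ⊗ ι) ⊗ z)   ≡⟨ cong (λ x → α ⊗ (x ⊗ z)) -ι⊗ι≡1ᴳ ⟩
  α ⊗ (1ᴳ ⊗ z)         ≡⟨ cong (α ⊗_) (⊗-identityˡ z) ⟩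
  α ⊗ z                ∎

-- Permanents

⊗-if : ∀ c b {x} → c ⊗ (if b then x else 0ᴳ) ≡ (if b then c ⊗ x else 0ᴳ)
⊗-if c true  = refl
⊗-if c false = ⊗-zeroʳ c

∑-if-∧ : ∀ {n} b (p : Fin n → Bool) (f : Fin n → GI) →
         ∑[ j < n ] (if b ∧ p j then f j else 0ᴳ) ≡ (if b then ∑[ j < n ] (if p j then f j else 0ᴳ) else 0ᴳ)
∑-if-∧         true  p f = refl
∑-if-∧ {n = n} false p f = sum-replicate-zero n

∑-punchIn : ∀ {n} (j : Fin (suc n)) (f : Fin (suc n) → GI) →
            ∑[ c < suc n ] (if not (does (c ≟ j)) then f c else 0ᴳ) ≡ ∑[ c < n ] f (punchIn j c)
∑-punchIn j f = begin
  ∑[ c < _ ] g c                           ≡⟨ sum-remove {i = j} g ⟩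
  g j ⊕ ∑[ c < _ ] g (punchIn j c)         ≡⟨ cong₂ _⊕_ (cong (λ b → if not b then f j else 0ᴳ) (dec-true (j ≟ j) refl))
                                                       (sum-cong-≗ λ c → cong (λ b → if not b then f (punchIn j c) else 0ᴳ)
                                                                              (dec-false (punchIn j c ≟ j) (punchInᵢ≢i j c))) ⟩
  0ᴳ ⊕ ∑[ c < _ ] f (punchIn j c)          ≡⟨ ⊕-identityˡ _ ⟩
  ∑[ c < _ ] f (punchIn j c)               ∎
  where g = λ c → if not (does (c ≟ j)) then f c else 0ᴳ

sumᴳ-++ : ∀ xs ys → sumᴳ (xs ++ ys) ≡ sumᴳ xs ⊕ sumᴳ ys
sumᴳ-++ []       ys = sym (⊕-identityˡ _)
sumᴳ-++ (x ∷ xs) ys = trans (cong (x ⊕_) (sumᴳ-++ xs ys)) (sym (⊕-assoc x _ _))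

sumᴳ-concatMap : ∀ {A B : Set} (F : B → GI) (g : A → List B) xs →
                 sumᴳ (map F (concatMap g xs)) ≡ sumᴳ (map (λ x → sumᴳ (map F (g x))) xs)
sumᴳ-concatMap F g []       = refl
sumᴳ-concatMap F g (x ∷ xs) = begin
  sumᴳ (map F (g x ++ concatMap g xs))                  ≡⟨ cong sumᴳ (map-++ F (g x) _) ⟩
  sumᴳ (map F (g x) ++ map F (concatMap g xs))          ≡⟨ sumᴳ-++ (map F (g x)) _ ⟩
  sumᴳ (map F (g x)) ⊕ sumᴳ (map F (concatMap g xs))   ≡⟨ cong (sumᴳ (map F (g x)) ⊕_) (sumᴳ-concatMap F g xs) ⟩
  sumᴳ (map (λ x → sumᴳ (map F (g x))) (x ∷ xs))        ∎

sumᴳ-filter : ∀ {A : Set} {P : A → Set} (P? : ∀ x → Dec (P x)) (F : A → GI) xs →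
              sumᴳ (map F (filter P? xs)) ≡ sumᴳ (map (λ x → if does (P? x) then F x else 0ᴳ) xs)
sumᴳ-filter P? F [] = refl
sumᴳ-filter P? F (x ∷ xs) with does (P? x)
... | true  = cong (F x ⊕_) (sumᴳ-filter P? F xs)
... | false = trans (sumᴳ-filter P? F xs) (sym (⊕-identityˡ _))

sumMaps : (m n : ℕ) → ((Fin m → Fin n) → GI) → GI
sumMaps zero    n F = F (λ ())
sumMaps (suc m) n F = sumMaps m n (λ f → ∑[ j < n ] F (j ∷ᶠ f))

sumMaps-cong : ∀ m n {F G : (Fin m → Fin n) → GI} → (∀ f → F f ≡ G f) → sumMaps m n F ≡ sumMaps m n G
sumMaps-cong zero    n F≡G = F≡G _
sumMaps-cong (suc m) n F≡G = sumMaps-cong m n (λ f → sum-cong-≗ (λ j → F≡G (j ∷ᶠ f)))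

sumMaps-comm-∑ : ∀ m n b (F : Fin b → (Fin m → Fin n) → GI) →
                 sumMaps m n (λ f → ∑[ j < b ] F j f) ≡ ∑[ j < b ] sumMaps m n (F j)
sumMaps-comm-∑ zero    n b F = refl
sumMaps-comm-∑ (suc m) n b F =
  trans (sumMaps-cong m n (λ f → ∑-comm (λ c j → F j (c ∷ᶠ f))))
        (sumMaps-comm-∑ m n b (λ j f → ∑[ c < n ] F j (c ∷ᶠ f)))

sumMaps-distribˡ : ∀ m n x (F : (Fin m → Fin n) → GI) → sumMaps m n (λ f → x ⊗ F f) ≡ x ⊗ sumMaps m n F
sumMaps-distribˡ zero    n x F = refl
sumMaps-distribˡ (suc m) n x F =
  trans (sumMaps-cong m n (λ f → sym (*-distribˡ-sum x (λ j → F (j ∷ᶠ f))))) (sumMaps-distribˡ m n x _)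

Avoids : ∀ {m n} → Fin n → (Fin m → Fin n) → Set
Avoids j g = ∀ r → g r ≢ j

avoids? : ∀ {m n} (j : Fin n) (g : Fin m → Fin n) → Dec (Avoids j g)
avoids? {zero}  j g = yes λ ()
avoids? {suc m} j g = map′ (λ (tail , head) → λ { zero → head ; (suc r) → tail r })
                           (λ avoids → avoids ∘ suc , avoids zero)
                           (avoids? j (g ∘ suc) ×-dec ¬? (g zero ≟ j))

sumMaps-avoiding : ∀ m n (j : Fin (suc n)) (F : (Fin m → Fin (suc n)) → GI) → F Preserves _≗_ ⟶ _≡_ →
                   sumMaps m (suc n) (λ g → if does (avoids? j g) then F g else 0ᴳ) ≡ sumMaps m n (λ h → F (punchIn j ∘ h))
sumMaps-avoiding zero    n j F F-cong = F-cong (λ ())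
sumMaps-avoiding (suc m) n j F F-cong = begin
  sumMaps m (suc n) (λ g → ∑[ c < suc n ] (if does (avoids? j g) ∧ not (does (c ≟ j)) then F (c ∷ᶠ g) else 0ᴳ))
    ≡⟨ sumMaps-cong m (suc n) (λ g → ∑-if-∧ {suc n} (does (avoids? j g)) (λ c → not (does (c ≟ j))) (λ c → F (c ∷ᶠ g))) ⟩
  sumMaps m (suc n) (λ g → if does (avoids? j g) then ∑[ c < suc n ] (if not (does (c ≟ j)) then F (c ∷ᶠ g) else 0ᴳ) else 0ᴳ)
    ≡⟨ sumMaps-cong m (suc n) (λ g → cong (if does (avoids? j g) then_else 0ᴳ) (∑-punchIn j (λ c → F (c ∷ᶠ g)))) ⟩
  sumMaps m (suc n) (λ g → if does (avoids? j g) then ∑[ c < n ] F (punchIn j c ∷ᶠ g) else 0ᴳ)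
    ≡⟨ sumMaps-avoiding m n j _ (λ {g} {h} g≗h → sum-cong-≗ λ c →
         F-cong {punchIn j c ∷ᶠ g} {punchIn j c ∷ᶠ h} λ { zero → refl ; (suc r) → g≗h r }) ⟩
  sumMaps m n (λ h → ∑[ c < n ] F (punchIn j c ∷ᶠ punchIn j ∘ h))
    ≡⟨ sumMaps-cong m n (λ h → sum-cong-≗ λ c →
         F-cong {punchIn j c ∷ᶠ punchIn j ∘ h} {punchIn j ∘ (c ∷ᶠ h)} λ { zero → refl ; (suc r) → refl }) ⟩
  sumMaps m n (λ h → ∑[ c < n ] F (punchIn j ∘ (c ∷ᶠ h)))  ∎

injective? : ∀ {m n} (g : Fin m → Fin n) → Dec (Injective _≡_ _≡_ g)
injective? {zero}  g = yes λ { {()} }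
injective? {suc m} g = map′ fromParts toParts (avoids? (g zero) (g ∘ suc) ×-dec injective? (g ∘ suc))
  where
  fromParts : Avoids (g zero) (g ∘ suc) × Injective _≡_ _≡_ (g ∘ suc) → Injective _≡_ _≡_ g
  fromParts _               {zero}  {zero}  _     = refl
  fromParts (avoids , _)    {zero}  {suc y} g0≡gy = contradiction (sym g0≡gy) (avoids y)
  fromParts (avoids , _)    {suc x} {zero}  gx≡g0 = contradiction gx≡g0 (avoids x)
  fromParts (_ , injective) {suc x} {suc y} gx≡gy = cong suc (injective gx≡gy)
  toParts : Injective _≡_ _≡_ g → Avoids (g zero) (g ∘ suc) × Injective _≡_ _≡_ (g ∘ suc)
  toParts injective = (λ r gr≡g0 → 0≢1+n (injective (sym gr≡g0))) , (λ gx≡gy → suc-injectiveᶠ (injective gx≡gy))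

injective?-cong : ∀ {m n} {f g : Fin m → Fin n} → f ≗ g → does (injective? f) ≡ does (injective? g)
injective?-cong {f = f} {g} f≗g = does-⇔ (mk⇔ (λ inj {x} {y} gx≡gy → inj (trans (f≗g x) (trans gx≡gy (sym (f≗g y)))))
                                                 (λ inj {x} {y} fx≡fy → inj (trans (sym (f≗g x)) (trans fx≡fy (f≗g y)))))
                                           (injective? f) (injective? g)

injective?-punchIn : ∀ {m n} (j : Fin (suc n)) (h : Fin m → Fin n) → does (injective? (punchIn j ∘ h)) ≡ does (injective? h)
injective?-punchIn j h = does-⇔ (mk⇔ (λ inj {x} {y} hx≡hy → inj (cong (punchIn j) hx≡hy))
                                     (λ inj {x} {y} jhx≡jhy → inj (punchIn-injective j (h x) (h y) jhx≡jhy)))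
                                (injective? (punchIn j ∘ h)) (injective? h)

prodᴳ-cong : ∀ n {f g : Fin n → GI} → f ≗ g → prodᴳ n f ≡ prodᴳ n g
prodᴳ-cong zero    f≗g = refl
prodᴳ-cong (suc n) f≗g = cong₂ _⊗_ (f≗g zero) (prodᴳ-cong n (f≗g ∘ suc))

-- sumMaps m n (injProd A) is the permanent of the m × n matrix A.
injProd : ∀ {m n} → (Fin m → Fin n → GI) → (Fin m → Fin n) → GI
injProd {m} A g = if does (injective? g) then prodᴳ m (λ r → A r (g r)) else 0ᴳ

injProd-cong : ∀ {m n} (A : Fin m → Fin n → GI) → injProd A Preserves _≗_ ⟶ _≡_
injProd-cong {m} A f≗g = cong₂ (if_then_else 0ᴳ) (injective?-cong f≗g) (prodᴳ-cong m (λ r → cong (A r) (f≗g r)))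

minor : ∀ {m n} → (Fin (suc m) → Fin (suc n) → GI) → Fin (suc n) → Fin m → Fin n → GI
minor A j r c = A (suc r) (punchIn j c)

laplace-term : ∀ m n (A : Fin (suc m) → Fin (suc n) → GI) j →
  sumMaps m (suc n) (λ g → if does (avoids? j g) ∧ does (injective? g) then A zero j ⊗ prodᴳ m (λ r → A (suc r) (g r)) else 0ᴳ)
  ≡ A zero j ⊗ sumMaps m n (injProd (minor A j))
laplace-term m n A j = begin
  sumMaps m (suc n) (λ g → if does (avoids? j g) ∧ does (injective? g) then A zero j ⊗ prodᴳ m (λ r → A (suc r) (g r)) else 0ᴳ)
    ≡⟨ sumMaps-cong m (suc n) (λ g → trans (if-∧ (does (avoids? j g)))
                                           (cong (if does (avoids? j g) then_else 0ᴳ) (sym (⊗-if (A zero j) (does (injective? g)))))) ⟩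
  sumMaps m (suc n) (λ g → if does (avoids? j g) then A zero j ⊗ injProd (A ∘ suc) g else 0ᴳ)
    ≡⟨ sumMaps-avoiding m n j (λ g → A zero j ⊗ injProd (A ∘ suc) g) (cong (A zero j ⊗_) ∘ injProd-cong (A ∘ suc)) ⟩
  sumMaps m n (λ h → A zero j ⊗ injProd (A ∘ suc) (punchIn j ∘ h))
    ≡⟨ sumMaps-cong m n (λ h → cong (λ b → A zero j ⊗ (if b then prodᴳ m (λ r → minor A j r (h r)) else 0ᴳ))
                                    (injective?-punchIn j h)) ⟩
  sumMaps m n (λ h → A zero j ⊗ injProd (minor A j) h)
    ≡⟨ sumMaps-distribˡ m n (A zero j) (injProd (minor A j)) ⟩
  A zero j ⊗ sumMaps m n (injProd (minor A j)) ∎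

sumMaps-laplace : ∀ m n (A : Fin (suc m) → Fin (suc n) → GI) →
  sumMaps (suc m) (suc n) (injProd A) ≡ ∑[ j < suc n ] (A zero j ⊗ sumMaps m n (injProd (minor A j)))
sumMaps-laplace m n A = trans
  (sumMaps-comm-∑ m (suc n) (suc n)
    (λ j g → if does (avoids? j g) ∧ does (injective? g) then A zero j ⊗ prodᴳ m (λ r → A (suc r) (g r)) else 0ᴳ))
  (sum-cong-≗ (laplace-term m n A))

-- `allFuns` enumerates Fin n with a helper local to Defs; unification recovers it here as allFin′.
mutual
  allFin′ : ℕ → ℕ → (n : ℕ) → List (Fin n)
  allFin′ = _

  private
    allFuns-unfolded : ∀ m n → Σ[ fins ∈ List (Fin n) ]
                       Σ[ extend ∈ ((Fin m → Fin (suc n)) → Fin (suc n) → Fin (suc m) → Fin (suc n)) ]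
                       allFuns (suc m) (suc n) ≡ concatMap (λ f → map (extend f) (zero ∷ map suc fins)) (allFuns m (suc n))
    allFuns-unfolded m n = _ , _ , refl

    allFin′-unifies : ∀ m n → proj₁ (allFuns-unfolded m n) ≡ allFin′ m (suc n) n
    allFin′-unifies m n with suc n
    ... | _ = refl

allFuns-suc : ∀ m n → Σ[ extend ∈ ((Fin m → Fin n) → Fin n → Fin (suc m) → Fin n) ]
              allFuns (suc m) n ≡ concatMap (λ f → map (extend f) (allFin′ m n n)) (allFuns m n)
allFuns-suc m n = _ , refl

sumᴳ-allFin′ : ∀ m p n (G : Fin n → GI) → sumᴳ (map G (allFin′ m p n)) ≡ ∑[ j < n ] G j
sumᴳ-allFin′ m p zero    G = refl
sumᴳ-allFin′ m p (suc n) G = cong (G zero ⊕_) (trans (cong sumᴳ (sym (map-∘ (allFin′ m p n)))) (sumᴳ-allFin′ m p n (G ∘ suc)))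

sumᴳ-allFuns : ∀ m n (F : (Fin m → Fin n) → GI) → F Preserves _≗_ ⟶ _≡_ → sumᴳ (map F (allFuns m n)) ≡ sumMaps m n F
sumᴳ-allFuns zero    n F F-cong = trans (⊕-identityʳ _) (F-cong λ ())
sumᴳ-allFuns (suc m) n F F-cong = begin
  sumᴳ (map F (concatMap (λ f → map (extend f) (allFin′ m n n)) (allFuns m n)))
    ≡⟨ sumᴳ-concatMap F _ (allFuns m n) ⟩
  sumᴳ (map (λ f → sumᴳ (map F (map (extend f) (allFin′ m n n)))) (allFuns m n))
    ≡⟨ cong sumᴳ (map-cong extend-sum (allFuns m n)) ⟩
  sumᴳ (map (λ f → ∑[ j < n ] F (j ∷ᶠ f)) (allFuns m n))
    ≡⟨ sumᴳ-allFuns m n _ (λ {f} {g} f≗g → sum-cong-≗ λ j →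
         F-cong {j ∷ᶠ f} {j ∷ᶠ g} λ { zero → refl ; (suc r) → f≗g r }) ⟩
  sumMaps (suc m) n F ∎
  where
  extend = proj₁ (allFuns-suc m n)
  extend-sum : ∀ f → sumᴳ (map F (map (extend f) (allFin′ m n n))) ≡ ∑[ j < n ] F (j ∷ᶠ f)
  extend-sum f = begin
    sumᴳ (map F (map (extend f) (allFin′ m n n))) ≡⟨ cong sumᴳ (sym (map-∘ (allFin′ m n n))) ⟩
    sumᴳ (map (F ∘ extend f) (allFin′ m n n))     ≡⟨ sumᴳ-allFin′ m n n (F ∘ extend f) ⟩
    ∑[ j < n ] F (extend f j)
      ≡⟨ sum-cong-≗ (λ j → F-cong {extend f j} {j ∷ᶠ f} λ { zero → refl ; (suc r) → refl }) ⟩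
    ∑[ j < n ] F (j ∷ᶠ f)                         ∎

IsPerm⇔Injective : ∀ {n} {σ : Fin n → Fin n} → IsPerm σ ⇔ Injective _≡_ _≡_ σ
IsPerm⇔Injective = mk⇔ (λ perm {r} {s} → perm r s) (λ inj r s → inj {r} {s})

per-as-sumMaps : ∀ n (A : Fin n → Fin n → GI) → per n A ≡ sumMaps n n (injProd A)
per-as-sumMaps n A = begin
  per n A ≡⟨ sumᴳ-filter isPerm? (λ σ → prodᴳ n (λ r → A r (σ r))) (allFuns n n) ⟩
  sumᴳ (map (λ σ → if does (isPerm? σ) then prodᴳ n (λ r → A r (σ r)) else 0ᴳ) (allFuns n n))
    ≡⟨ cong sumᴳ (map-cong (λ σ → cong (if_then prodᴳ n (λ r → A r (σ r)) else 0ᴳ)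
                                       (does-⇔ IsPerm⇔Injective (isPerm? σ) (injective? σ))) (allFuns n n)) ⟩
  sumᴳ (map (injProd A) (allFuns n n)) ≡⟨ sumᴳ-allFuns n n (injProd A) (injProd-cong A) ⟩
  sumMaps n n (injProd A) ∎

per-cong : ∀ n (A B : Fin n → Fin n → GI) → (∀ r c → A r c ≡ B r c) → per n A ≡ per n B
per-cong n A B A≡B = cong sumᴳ (map-cong (λ σ → prodᴳ-cong n (λ r → A≡B r (σ r))) (permutations n))

per-laplace : ∀ n (A : Fin (suc n) → Fin (suc n) → GI) → per (suc n) A ≡ ∑[ j < suc n ] (A zero j ⊗ per n (minor A j))
per-laplace n A = begin
  per (suc n) A                                               ≡⟨ per-as-sumMaps (suc n) A ⟩
  sumMaps (suc n) (suc n) (injProd A)                         ≡⟨ sumMaps-laplace n n A ⟩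
  ∑[ j < suc n ] (A zero j ⊗ sumMaps n n (injProd (minor A j)))
    ≡⟨ sum-cong-≗ (λ j → cong (A zero j ⊗_) (sym (per-as-sumMaps n (minor A j)))) ⟩
  ∑[ j < suc n ] (A zero j ⊗ per n (minor A j))                 ∎

-- Finite sums of natural numbers

𝟙 : {A : Set} → Dec A → ℕ
𝟙 d = if does d then 1 else 0

𝟙-yes : {A : Set} (d : Dec A) → A → 𝟙 d ≡ 1
𝟙-yes d a = cong (if_then 1 else 0) (dec-true d a)

𝟙-no : {A : Set} (d : Dec A) → ¬ A → 𝟙 d ≡ 0
𝟙-no d ¬a = cong (if_then 1 else 0) (dec-false d ¬a)

sumℕ : ℕ → (ℕ → ℕ) → ℕ
sumℕ zero    f = 0
sumℕ (suc n) f = f 0 + sumℕ n (f ∘ suc)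

sumℕ-cong : ∀ n {f g : ℕ → ℕ} → (∀ j → j < n → f j ≡ g j) → sumℕ n f ≡ sumℕ n g
sumℕ-cong zero    f≡g = refl
sumℕ-cong (suc n) f≡g = cong₂ _+_ (f≡g 0 z<s) (sumℕ-cong n (λ j j<n → f≡g (suc j) (s<s j<n)))

sumℕ-zero : ∀ n {f : ℕ → ℕ} → (∀ j → j < n → f j ≡ 0) → sumℕ n f ≡ 0
sumℕ-zero zero    f≡0 = refl
sumℕ-zero (suc n) f≡0 = cong₂ _+_ (f≡0 0 z<s) (sumℕ-zero n (λ j j<n → f≡0 (suc j) (s<s j<n)))

sumℕ-distrib-+ : ∀ n (f g : ℕ → ℕ) → sumℕ n (λ j → f j + g j) ≡ sumℕ n f + sumℕ n g
sumℕ-distrib-+ zero    f g = refl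
sumℕ-distrib-+ (suc n) f g = begin
  (f 0 + g 0) + sumℕ n (λ j → f (suc j) + g (suc j))  ≡⟨ cong ((f 0 + g 0) +_) (sumℕ-distrib-+ n (f ∘ suc) (g ∘ suc)) ⟩
  (f 0 + g 0) + (sumℕ n (f ∘ suc) + sumℕ n (g ∘ suc)) ≡⟨ +-interchange (f 0) (g 0) _ _ ⟩
  (f 0 + sumℕ n (f ∘ suc)) + (g 0 + sumℕ n (g ∘ suc)) ∎

sumℕ-truncate : ∀ {r n} {f : ℕ → ℕ} → r ≤ n → (∀ j → r ≤ j → f j ≡ 0) → sumℕ n f ≡ sumℕ r f
sumℕ-truncate {zero}  {n}     _ f≡0 = sumℕ-zero n (λ j _ → f≡0 j z≤n)
sumℕ-truncate {suc r} {suc n} (s≤s r≤n) f≡0 = cong (_ +_) (sumℕ-truncate r≤n (λ j r≤j → f≡0 (suc j) (s≤s r≤j)))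

sumℕ-cutoff : ∀ {r s} {f : ℕ → ℕ} → (∀ j → r ≤ j → f j ≡ 0) → (∀ j → s ≤ j → f j ≡ 0) → sumℕ r f ≡ sumℕ s f
sumℕ-cutoff {r} {s} f≥r≡0 f≥s≡0 =
  trans (sym (sumℕ-truncate (m≤m+n r s) f≥r≡0)) (sumℕ-truncate (m≤n+m s r) f≥s≡0)

sumℕ-pred : ∀ {n} (f : ℕ → ℕ) → 1 ≤ n → sumℕ n f ≡ f 0 + sumℕ (n ∸ 1) (f ∘ suc)
sumℕ-pred {suc n} f _ = refl

sumℕ-δ : ∀ {n p} {f : ℕ → ℕ} → p < n → f p ≡ 1 → (∀ j → j < n → j ≢ p → f j ≡ 0) → sumℕ n f ≡ 1
sumℕ-δ {suc n} {zero}  z<s f0≡1 f≡0 = cong₂ _+_ f0≡1 (sumℕ-zero n (λ j j<n → f≡0 (suc j) (s<s j<n) λ ()))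
sumℕ-δ {suc n} {suc p} (s<s p<n) fp≡1 f≡0 =
  cong₂ _+_ (f≡0 0 z<s λ ()) (sumℕ-δ p<n fp≡1 (λ j j<n j≢p → f≡0 (suc j) (s<s j<n) (j≢p ∘ suc-injective)))

convolution : ℕ → (ℕ → ℕ) → (ℕ → ℕ) → ℕ
convolution zero    c p = c 0 * p 0
convolution (suc m) c p = c 0 * p (suc m) + convolution m (c ∘ suc) p

infixl 9 _‼_
_‼_ : List ℕ → ℕ → ℕ
[]       ‼ j     = 0
(x ∷ xs) ‼ zero  = x
(x ∷ xs) ‼ suc j = xs ‼ j

‼-map-applyUpTo : ∀ (g f : ℕ → ℕ) {n j} → j < n → map g (applyUpTo f n) ‼ j ≡ g (f j)
‼-map-applyUpTo g f {suc n} {zero}  _         = refl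
‼-map-applyUpTo g f {suc n} {suc j} (s<s j<n) = ‼-map-applyUpTo g (f ∘ suc) j<n

‼-map-applyUpTo-beyond : ∀ (g f : ℕ → ℕ) {n j} → n ≤ j → map g (applyUpTo f n) ‼ j ≡ 0
‼-map-applyUpTo-beyond g f {zero}  _         = refl
‼-map-applyUpTo-beyond g f {suc n} (s≤s n≤j) = ‼-map-applyUpTo-beyond g (f ∘ suc) n≤j

sum-take≡sumℕ : ∀ p xs → foldr _+_ 0 (take p xs) ≡ sumℕ p (xs ‼_)
sum-take≡sumℕ zero    xs       = refl
sum-take≡sumℕ (suc p) []       = sym (sumℕ-zero p (λ _ _ → refl))
sum-take≡sumℕ (suc p) (x ∷ xs) = cong (x +_) (sum-take≡sumℕ p xs)

<∸1⇒suc< : ∀ {j k} → j < k ∸ 1 → suc j < k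
<∸1⇒suc< {k = suc k} j<k = s<s j<k

-- `initial` lists its entries through a local function of Defs that cannot be named directly.
initial-as-map : ∀ k i → Σ[ entry ∈ (ℕ → ℕ) ] initial k i ≡ map entry (upTo k)
initial-as-map k i = _ , refl

initial-entry : ∀ k i j → proj₁ (initial-as-map k i) j ≡ 𝟙 (suc j ℕ.≟ i)
initial-entry k i j with suc j ℕ.≟ i
... | yes 1+j≡i = sym (𝟙-yes (suc j ℕ.≟ i) 1+j≡i)
... | no  1+j≢i = sym (𝟙-no (suc j ℕ.≟ i) 1+j≢i)

⊗-𝟙-yes : {A : Set} (x : GI) (d : Dec A) → A → x ⊗ fromℕᴳ (𝟙 d) ≡ x
⊗-𝟙-yes x d a = trans (cong (λ n → x ⊗ fromℕᴳ n) (𝟙-yes d a)) (⊗-identityʳ x)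

⊗-𝟙-no : {A : Set} (x : GI) (d : Dec A) → ¬ A → x ⊗ fromℕᴳ (𝟙 d) ≡ 0ᴳ
⊗-𝟙-no x d ¬a = trans (cong (λ n → x ⊗ fromℕᴳ n) (𝟙-no d ¬a)) (⊗-zeroʳ x)

ιcol : (ℕ → ℕ) → ℕ → GI
ιcol c d = ι^ d ⊗ fromℕᴳ (c d)

⊗-ιcol₀ : ∀ α c y → (α ⊗ ιcol c 0) ⊗ fromℕᴳ y ≡ α ⊗ fromℕᴳ (c 0 * y)
⊗-ιcol₀ α c y = begin
  (α ⊗ (1ᴳ ⊗ fromℕᴳ (c 0))) ⊗ fromℕᴳ y  ≡⟨ cong (λ x → (α ⊗ x) ⊗ fromℕᴳ y) (⊗-identityˡ _) ⟩
  (α ⊗ fromℕᴳ (c 0)) ⊗ fromℕᴳ y         ≡⟨ ⊗-assoc α _ _ ⟩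
  α ⊗ (fromℕᴳ (c 0) ⊗ fromℕᴳ y)         ≡⟨ cong (α ⊗_) (sym (fromℕᴳ-* (c 0) y)) ⟩
  α ⊗ fromℕᴳ (c 0 * y)                  ∎

-- Generalized order-k numbers and the matrices H_{k,m}

module _ (k lam : ℕ) where

  next-‼ : ∀ L → next k lam L ≡ lam * L ‼ 0 + sumℕ (k ∸ 1) (λ j → L ‼ suc j)
  next-‼ []       = sym (cong₂ _+_ (*-zeroʳ lam) (sumℕ-zero (k ∸ 1) (λ _ _ → refl)))
  next-‼ (x ∷ xs) = cong (lam * x +_) (sum-take≡sumℕ (k ∸ 1) xs)

  next-+ : ∀ {L L₁ L₂} → L ‼ 0 ≡ L₁ ‼ 0 + L₂ ‼ 0 →
           (∀ j → j < k ∸ 1 → L ‼ suc j ≡ L₁ ‼ suc j + L₂ ‼ suc j) →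
           next k lam L ≡ next k lam L₁ + next k lam L₂
  next-+ {L} {L₁} {L₂} head tail = begin
    next k lam L                                         ≡⟨ next-‼ L ⟩
    lam * L ‼ 0 + sumℕ (k ∸ 1) (λ j → L ‼ suc j)
      ≡⟨ cong₂ _+_ (cong (lam *_) head) (sumℕ-cong (k ∸ 1) tail) ⟩
    lam * (L₁ ‼ 0 + L₂ ‼ 0) + sumℕ (k ∸ 1) (λ j → L₁ ‼ suc j + L₂ ‼ suc j)
      ≡⟨ cong₂ _+_ (*-distribˡ-+ lam _ _) (sumℕ-distrib-+ (k ∸ 1) _ _) ⟩
    (lam * L₁ ‼ 0 + lam * L₂ ‼ 0) + (sumℕ (k ∸ 1) (λ j → L₁ ‼ suc j) + sumℕ (k ∸ 1) (λ j → L₂ ‼ suc j))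
      ≡⟨ +-interchange (lam * L₁ ‼ 0) (lam * L₂ ‼ 0) _ _ ⟩
    (lam * L₁ ‼ 0 + sumℕ (k ∸ 1) (λ j → L₁ ‼ suc j)) + (lam * L₂ ‼ 0 + sumℕ (k ∸ 1) (λ j → L₂ ‼ suc j))
      ≡⟨ sym (cong₂ _+_ (next-‼ L₁) (next-‼ L₂)) ⟩
    next k lam L₁ + next k lam L₂                        ∎

  -- past i n j = a^i_{n-j}, read off the history list; it is 0 below the initial window.
  past : ℕ → ℕ → ℕ → ℕ
  past i n j = history k lam i n ‼ j

  a¹ : ℕ → ℕ
  a¹ n = past 1 n 0

  past-head : ∀ i n → past i (suc n) 0 ≡ lam * past i n 0 + sumℕ (k ∸ 1) (λ j → past i n (suc j))
  past-head i n = next-‼ (history k lam i n)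

  past-shift : ∀ i n j → past i n (n + j) ≡ past i 0 j
  past-shift i zero    j = refl
  past-shift i (suc n) j = past-shift i n j

  past₀ : ∀ {i j} → j < k → past i 0 j ≡ 𝟙 (suc j ℕ.≟ i)
  past₀ {i} {j} j<k = trans (‼-map-applyUpTo (proj₁ (initial-as-map k i)) (λ x → x) j<k) (initial-entry k i j)

  past₀-one : ∀ {i j} → suc j ≡ i → j < k → past i 0 j ≡ 1
  past₀-one {i} {j} 1+j≡i j<k = trans (past₀ j<k) (𝟙-yes (suc j ℕ.≟ i) 1+j≡i)

  past₀-zero : ∀ {i j} → (j < k → suc j ≢ i) → past i 0 j ≡ 0
  past₀-zero {i} {j} 1+j≢i with j <? k
  ... | yes j<k = trans (past₀ j<k) (𝟙-no (suc j ℕ.≟ i) (1+j≢i j<k))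
  ... | no  j≮k = ‼-map-applyUpTo-beyond (proj₁ (initial-as-map k i)) (λ x → x) (≮⇒≥ j≮k)

  past[k+1]≡0 : ∀ n j → past (suc k) n j ≡ 0
  past[k+1]≡0 zero    j       = past₀-zero (λ j<k 1+j≡1+k → <⇒≢ j<k (suc-injective 1+j≡1+k))
  past[k+1]≡0 (suc n) (suc j) = past[k+1]≡0 n j
  past[k+1]≡0 (suc n) zero    = begin
    past (suc k) (suc n) 0                                          ≡⟨ past-head (suc k) n ⟩
    lam * past (suc k) n 0 + sumℕ (k ∸ 1) (λ j → past (suc k) n (suc j))
      ≡⟨ cong₂ _+_ (cong (lam *_) (past[k+1]≡0 n 0)) (sumℕ-zero (k ∸ 1) (λ j _ → past[k+1]≡0 n (suc j))) ⟩
    lam * 0 + 0                                                     ≡⟨ cong (_+ 0) (*-zeroʳ lam) ⟩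
    0                                                               ∎

  past-split : ∀ {i} → 2 ≤ i → i ≤ k → ∀ n j → j < n + k → past i (suc n) j ≡ past (suc i) n j + past 1 n j
  past-split {suc (suc i)} (s≤s (s≤s _)) i≤k zero zero _ = begin
    past (2 + i) 1 0                                               ≡⟨ past-head (2 + i) 0 ⟩
    lam * past (2 + i) 0 0 + sumℕ (k ∸ 1) (λ j → past (2 + i) 0 (suc j))
      ≡⟨ cong₂ _+_ (cong (lam *_) (past₀-zero λ _ ())) (sumℕ-δ (∸-monoˡ-≤ 1 i≤k) (past₀-one refl i≤k)
                     (λ j _ j≢i → past₀-zero (λ _ e → j≢i (suc-injective (suc-injective e))))) ⟩
    lam * 0 + 1                                                    ≡⟨ cong (_+ 1) (*-zeroʳ lam) ⟩
    0 + 1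
      ≡⟨ sym (cong₂ _+_ (past₀-zero λ _ ()) (past₀-one refl (≤-trans (s≤s z≤n) i≤k))) ⟩
    past (3 + i) 0 0 + past 1 0 0                                  ∎
  past-split {1} (s≤s ()) _ zero zero _
  past-split {i} _ _ zero (suc j) 1+j<k = begin
    past i 0 j                              ≡⟨ past₀ (<-trans (n<1+n j) 1+j<k) ⟩
      -- suc j ≟ i and suc (suc j) ≟ suc i compute the same boolean
    𝟙 (suc (suc j) ℕ.≟ suc i)               ≡⟨ sym (past₀ 1+j<k) ⟩
    past (suc i) 0 (suc j)                  ≡⟨ sym (+-identityʳ _) ⟩
    past (suc i) 0 (suc j) + 0              ≡⟨ cong (past (suc i) 0 (suc j) +_) (sym (past₀-zero λ _ ())) ⟩
    past (suc i) 0 (suc j) + past 1 0 (suc j) ∎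
  past-split {i} 2≤i i≤k (suc n) zero _ =
    next-+ {history k lam i (suc n)} {history k lam (suc i) n} {history k lam 1 n}
           (past-split 2≤i i≤k n 0 (≤-trans 1≤k (m≤n+m k n)))
           (λ j j<k∸1 → past-split 2≤i i≤k n (suc j) (≤-trans (<∸1⇒suc< j<k∸1) (m≤n+m k n)))
    where
    1≤k : 1 ≤ k
    1≤k = ≤-trans (≤-trans (s≤s z≤n) 2≤i) i≤k
  past-split 2≤i i≤k (suc n) (suc j) (s<s j<n+k) = past-split 2≤i i≤k n j j<n+k

  past-head≡sumℕ : ∀ r {i} → r + i ≡ suc k → 2 ≤ i → ∀ n → past i (suc n) 0 ≡ sumℕ r (past 1 n)
  past-head≡sumℕ zero    refl _ n = past[k+1]≡0 (suc n) 0
  past-head≡sumℕ (suc r) {i} 1+r+i≡1+k 2≤i n = begin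
    past i (suc n) 0                              ≡⟨ past-split 2≤i i≤k n 0 (≤-trans 1≤k (m≤n+m k n)) ⟩
    past (suc i) n 0 + past 1 n 0                 ≡⟨ cong (_+ past 1 n 0) (shifted n) ⟩
    sumℕ r (λ j → past 1 n (suc j)) + past 1 n 0  ≡⟨ +-comm _ (past 1 n 0) ⟩
    sumℕ (suc r) (past 1 n)                       ∎
    where
    i≤k : i ≤ k
    i≤k = subst (i ≤_) (suc-injective 1+r+i≡1+k) (m≤n+m i r)
    1≤k : 1 ≤ k
    1≤k = ≤-trans (≤-trans (s≤s z≤n) 2≤i) i≤k
    shifted : ∀ n → past (suc i) n 0 ≡ sumℕ r (λ j → past 1 n (suc j))
    shifted zero    = trans (past₀-zero λ _ 1≡1+i → <⇒≢ (≤-trans (s≤s z≤n) 2≤i) (suc-injective 1≡1+i))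
                            (sym (sumℕ-zero r (λ _ _ → past₀-zero λ _ ())))
    shifted (suc n) = past-head≡sumℕ r (trans (+-suc r i) 1+r+i≡1+k) (≤-trans 2≤i (n≤1+n i)) n

  convolution-a¹ : ∀ m c → convolution m c a¹ ≡ sumℕ (suc m) (λ j → c j * past 1 m j)
  convolution-a¹ zero    c = sym (+-identityʳ _)
  convolution-a¹ (suc m) c = cong (c 0 * a¹ (suc m) +_) (convolution-a¹ m (c ∘ suc))

  past¹-beyond : ∀ m j → suc m ≤ j → past 1 m j ≡ 0
  past¹-beyond m j m<j = begin
    past 1 m j             ≡⟨ cong (past 1 m) (sym (m+[n∸m]≡n (<⇒≤ m<j))) ⟩
    past 1 m (m + (j ∸ m)) ≡⟨ past-shift 1 m (j ∸ m) ⟩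
    past 1 0 (j ∸ m)       ≡⟨ past₀-zero (λ _ e → <⇒≱ m<j (m∸n≡0⇒m≤n (suc-injective e))) ⟩
    0                      ∎

  convolution-a¹-support : ∀ m c r → (∀ j → r ≤ j → c j ≡ 0) → convolution m c a¹ ≡ sumℕ r (λ j → c j * past 1 m j)
  convolution-a¹-support m c r c≡0 = trans (convolution-a¹ m c) (sumℕ-cutoff
    (λ j m<j → trans (cong (c j *_) (past¹-beyond m j m<j)) (*-zeroʳ (c j)))
    (λ j r≤j → cong (_* past 1 m j) (c≡0 j r≤j)))

  -- Entry d of the first column of H_{k,m} is ι^d · cH d, and that of H^i_{k,n} is ι^d · cI i d.
  cH : ℕ → ℕ
  cH zero    = lam
  cH (suc d) = 𝟙 (suc d <? k)

  cI : ℕ → ℕ → ℕ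
  cI i d = 𝟙 (d + i ≤? k)

  convolution-cH : 1 ≤ k → ∀ m → convolution m cH a¹ ≡ a¹ (suc m)
  convolution-cH 1≤k m = begin
    convolution m cH a¹                                          ≡⟨ convolution-a¹-support m cH k cH≡0 ⟩
    sumℕ k (λ j → cH j * past 1 m j)                             ≡⟨ sumℕ-pred _ 1≤k ⟩
    lam * past 1 m 0 + sumℕ (k ∸ 1) (λ j → cH (suc j) * past 1 m (suc j))
      ≡⟨ cong (lam * past 1 m 0 +_) (sumℕ-cong (k ∸ 1) λ j j<k∸1 →
           trans (cong (_* past 1 m (suc j)) (𝟙-yes (suc j <? k) (<∸1⇒suc< j<k∸1))) (*-identityˡ _)) ⟩
    lam * past 1 m 0 + sumℕ (k ∸ 1) (λ j → past 1 m (suc j))     ≡⟨ sym (past-head 1 m) ⟩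
    a¹ (suc m)                                                   ∎
    where
    cH≡0 : ∀ j → k ≤ j → cH j ≡ 0
    cH≡0 zero    k≤0 = contradiction (≤-trans 1≤k k≤0) λ ()
    cH≡0 (suc j) k≤j = 𝟙-no (suc j <? k) (≤⇒≯ k≤j)

  convolution-cI : ∀ {i} → 2 ≤ i → i ≤ k → ∀ m → convolution m (cI i) a¹ ≡ past i (suc m) 0
  convolution-cI {i} 2≤i i≤k m = begin
    convolution m (cI i) a¹               ≡⟨ convolution-a¹-support m (cI i) r cI≡0 ⟩
    sumℕ r (λ j → cI i j * past 1 m j)    ≡⟨ sumℕ-cong r (λ j j<r → trans (cong (_* past 1 m j) (cI≡1 j j<r)) (*-identityˡ _)) ⟩
    sumℕ r (past 1 m)                     ≡⟨ sym (past-head≡sumℕ r r+i≡1+k 2≤i m) ⟩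
    past i (suc m) 0                      ∎
    where
    r : ℕ
    r = suc k ∸ i
    r+i≡1+k : r + i ≡ suc k
    r+i≡1+k = m∸n+n≡m (≤-trans i≤k (n≤1+n k))
    cI≡1 : ∀ j → j < r → cI i j ≡ 1
    cI≡1 j j<r = 𝟙-yes (j + i ≤? k) (≤-pred (subst (suc (j + i) ≤_) r+i≡1+k (+-monoˡ-≤ i j<r)))
    cI≡0 : ∀ j → r ≤ j → cI i j ≡ 0
    cI≡0 j r≤j = 𝟙-no (j + i ≤? k) (<⇒≱ (subst (_≤ j + i) r+i≡1+k (+-monoˡ-≤ i r≤j)))

  -- The (s, t) entry of every H_{k,m}; it depends only on s - t.
  hEntry : ℕ → ℕ → GI
  hEntry s       zero          = ιcol cH s
  hEntry zero    (suc zero)    = -ι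
  hEntry zero    (suc (suc t)) = 0ᴳ
  hEntry (suc s) (suc t)       = hEntry s t

  Hmat : (m : ℕ) → Fin m → Fin m → GI
  Hmat m s t = hEntry (toℕ s) (toℕ t)

  Hcol : (m : ℕ) → (ℕ → GI) → Fin m → Fin m → GI
  Hcol m v s zero    = v (toℕ s)
  Hcol m v s (suc t) = hEntry (toℕ s) (suc (toℕ t))

  hEntry-diagonal : ∀ s → hEntry s s ≡ fromℕᴳ lam
  hEntry-diagonal zero    = ⊗-identityˡ (fromℕᴳ lam)
  hEntry-diagonal (suc s) = hEntry-diagonal s

  hEntry-superdiagonal : ∀ s → hEntry s (suc s) ≡ -ι
  hEntry-superdiagonal zero    = refl
  hEntry-superdiagonal (suc s) = hEntry-superdiagonal s

  hEntry-below : ∀ {s t} → t < s → hEntry s t ≡ ι^ (s ∸ t) ⊗ fromℕᴳ (𝟙 (s ∸ t <? k))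
  hEntry-below {suc s} {zero}  _         = refl
  hEntry-below {suc s} {suc t} (s<s t<s) = hEntry-below t<s

  hEntry-above : ∀ s t → ¬ t < s → s ≢ t → suc s ≢ t → hEntry s t ≡ 0ᴳ
  hEntry-above zero    zero          _   s≢t _     = contradiction refl s≢t
  hEntry-above zero    (suc zero)    _   _   1≢t   = contradiction refl 1≢t
  hEntry-above zero    (suc (suc t)) _   _   _     = refl
  hEntry-above (suc s) zero          t≮s _   _     = contradiction z<s t≮s
  hEntry-above (suc s) (suc t)       t≮s s≢t 1+s≢t =
    hEntry-above s t (t≮s ∘ s<s) (s≢t ∘ cong suc) (1+s≢t ∘ cong suc)

  H≡Hmat : ∀ m (s t : Fin m) → H k lam m s t ≡ Hmat m s t
  H≡Hmat m s t with toℕ s ℕ.≟ toℕ t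
  ... | yes s≡t = sym (trans (cong (hEntry (toℕ s)) (sym s≡t)) (hEntry-diagonal (toℕ s)))
  ... | no  s≢t with suc (toℕ s) ℕ.≟ toℕ t
  ...   | yes 1+s≡t = sym (trans (cong (hEntry (toℕ s)) (sym 1+s≡t)) (hEntry-superdiagonal (toℕ s)))
  ...   | no  1+s≢t with toℕ t <? toℕ s
  ...     | no  t≮s = sym (hEntry-above (toℕ s) (toℕ t) t≮s s≢t 1+s≢t)
  ...     | yes t<s with toℕ s ∸ toℕ t <? k
  ...       | yes d<k = sym (trans (hEntry-below t<s) (⊗-𝟙-yes (ι^ (toℕ s ∸ toℕ t)) (toℕ s ∸ toℕ t <? k) d<k))
  ...       | no  d≮k = sym (trans (hEntry-below t<s) (⊗-𝟙-no (ι^ (toℕ s ∸ toℕ t)) (toℕ s ∸ toℕ t <? k) d≮k))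

  Hi≡Hcol : ∀ {i} → i ≤ k → ∀ m (r c : Fin (suc m)) → Hi k lam i (suc m) r c ≡ Hcol (suc m) (ιcol (cI i)) r c
  Hi≡Hcol {i} i≤k m       zero    zero          = sym (⊗-𝟙-yes 1ᴳ (i ≤? k) i≤k)
  Hi≡Hcol     i≤k m       zero    (suc zero)    = refl
  Hi≡Hcol     i≤k m       zero    (suc (suc t)) = refl
  Hi≡Hcol {i} i≤k m       (suc r) zero with suc (toℕ r) + i ≤? k
  ... | yes r+i≤k = sym (⊗-𝟙-yes (ι^ (suc (toℕ r))) (suc (toℕ r) + i ≤? k) r+i≤k)
  ... | no  r+i≰k = sym (⊗-𝟙-no (ι^ (suc (toℕ r))) (suc (toℕ r) + i ≤? k) r+i≰k)
  Hi≡Hcol     i≤k m       (suc r) (suc c) = H≡Hmat m r c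

  per-Hcol-one : ∀ v → per 1 (Hcol 1 v) ≡ v 0
  per-Hcol-one v = trans (per-laplace 0 (Hcol 1 v)) (trans (⊕-identityʳ _) (⊗-identityʳ (v 0)))

  per-Hcol-expand : ∀ m v → per (2 + m) (Hcol (2 + m) v) ≡
                    v 0 ⊗ per (suc m) (Hmat (suc m)) ⊕ -ι ⊗ per (suc m) (Hcol (suc m) (v ∘ suc))
  per-Hcol-expand m v = begin
    per (2 + m) (Hcol (2 + m) v)
      ≡⟨ per-laplace (suc m) (Hcol (2 + m) v) ⟩
    v 0 ⊗ per (suc m) (Hmat (suc m)) ⊕ (-ι ⊗ per (suc m) (minor (Hcol (2 + m) v) (suc zero)) ⊕
      ∑[ j < m ] (0ᴳ ⊗ per (suc m) (minor (Hcol (2 + m) v) (suc (suc j)))))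
      ≡⟨ cong₂ (λ x y → v 0 ⊗ per (suc m) (Hmat (suc m)) ⊕ (-ι ⊗ x ⊕ y)) second-minor other-columns ⟩
    v 0 ⊗ per (suc m) (Hmat (suc m)) ⊕ (-ι ⊗ per (suc m) (Hcol (suc m) (v ∘ suc)) ⊕ 0ᴳ)
      ≡⟨ cong (v 0 ⊗ per (suc m) (Hmat (suc m)) ⊕_) (⊕-identityʳ _) ⟩
    v 0 ⊗ per (suc m) (Hmat (suc m)) ⊕ -ι ⊗ per (suc m) (Hcol (suc m) (v ∘ suc)) ∎
    where
    second-minor : per (suc m) (minor (Hcol (2 + m) v) (suc zero)) ≡ per (suc m) (Hcol (suc m) (v ∘ suc))
    second-minor = per-cong (suc m) (minor (Hcol (2 + m) v) (suc zero)) (Hcol (suc m) (v ∘ suc)) λ r → λ { zero → refl ; (suc c) → refl }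
    other-columns : ∑[ j < m ] (0ᴳ ⊗ per (suc m) (minor (Hcol (2 + m) v) (suc (suc j)))) ≡ 0ᴳ
    other-columns = trans (sum-cong-≗ λ j → ⊗-zeroˡ (per (suc m) (minor (Hcol (2 + m) v) (suc (suc j))))) (sum-replicate-zero m)

  per-Hcol-scaled : ∀ m (p : ℕ → ℕ) → (∀ t → t ≤ m → per t (Hmat t) ≡ fromℕᴳ (p t)) → ∀ α c →
                    per (suc m) (Hcol (suc m) (λ r → α ⊗ ιcol c r)) ≡ α ⊗ fromℕᴳ (convolution m c p)
  per-Hcol-scaled zero p per-H≤ α c = begin
    per 1 (Hcol 1 (λ r → α ⊗ ιcol c r))  ≡⟨ per-Hcol-one (λ r → α ⊗ ιcol c r) ⟩
    α ⊗ ιcol c 0                         ≡⟨ sym (⊗-identityʳ _) ⟩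
    (α ⊗ ιcol c 0) ⊗ 1ᴳ                  ≡⟨ cong ((α ⊗ ιcol c 0) ⊗_) (per-H≤ 0 z≤n) ⟩
    (α ⊗ ιcol c 0) ⊗ fromℕᴳ (p 0)        ≡⟨ ⊗-ιcol₀ α c (p 0) ⟩
    α ⊗ fromℕᴳ (c 0 * p 0)               ∎
  per-Hcol-scaled (suc m) p per-H≤ α c = begin
    per (2 + m) (Hcol (2 + m) v)
      ≡⟨ per-Hcol-expand m v ⟩
    v 0 ⊗ per (suc m) (Hmat (suc m)) ⊕ -ι ⊗ per (suc m) (Hcol (suc m) (v ∘ suc))
      ≡⟨ cong₂ (λ x y → v 0 ⊗ x ⊕ -ι ⊗ y) (per-H≤ (suc m) ≤-refl)
               (trans (per-cong (suc m) (Hcol (suc m) (v ∘ suc)) _ shift)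
                      (per-Hcol-scaled m p (λ t t≤m → per-H≤ t (m≤n⇒m≤1+n t≤m)) (α ⊗ ι) (c ∘ suc))) ⟩
    v 0 ⊗ fromℕᴳ (p (suc m)) ⊕ -ι ⊗ ((α ⊗ ι) ⊗ fromℕᴳ (convolution m (c ∘ suc) p))
      ≡⟨ cong₂ _⊕_ (⊗-ιcol₀ α c (p (suc m))) (-ι-cancel α _) ⟩
    α ⊗ fromℕᴳ (c 0 * p (suc m)) ⊕ α ⊗ fromℕᴳ (convolution m (c ∘ suc) p)
      ≡⟨ sym (⊗-distribˡ-⊕ α (fromℕᴳ (c 0 * p (suc m))) (fromℕᴳ (convolution m (c ∘ suc) p))) ⟩
    α ⊗ (fromℕᴳ (c 0 * p (suc m)) ⊕ fromℕᴳ (convolution m (c ∘ suc) p))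
      ≡⟨ cong (α ⊗_) (sym (fromℕᴳ-+ (c 0 * p (suc m)) (convolution m (c ∘ suc) p))) ⟩
    α ⊗ fromℕᴳ (convolution (suc m) c p) ∎
    where
    v : ℕ → GI
    v r = α ⊗ ιcol c r
    shift : ∀ r c′ → Hcol (suc m) (v ∘ suc) r c′ ≡ Hcol (suc m) (λ r → (α ⊗ ι) ⊗ ιcol (c ∘ suc) r) r c′
    shift r zero     = trans (cong (α ⊗_) (⊗-assoc ι (ι^ (toℕ r)) (fromℕᴳ (c (suc (toℕ r))))))
                             (sym (⊗-assoc α ι (ιcol (c ∘ suc) (toℕ r))))
    shift r (suc c′) = refl

  per-Hcol : ∀ m (p : ℕ → ℕ) → (∀ t → t ≤ m → per t (Hmat t) ≡ fromℕᴳ (p t)) → ∀ c →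
             per (suc m) (Hcol (suc m) (ιcol c)) ≡ fromℕᴳ (convolution m c p)
  per-Hcol m p per-H≤ c = begin
    per (suc m) (Hcol (suc m) (ιcol c))
      ≡⟨ per-cong (suc m) (Hcol (suc m) (ιcol c)) (Hcol (suc m) (λ r → 1ᴳ ⊗ ιcol c r))
                  (λ r → λ { zero → sym (⊗-identityˡ (ιcol c (toℕ r))) ; (suc _) → refl }) ⟩
    per (suc m) (Hcol (suc m) (λ r → 1ᴳ ⊗ ιcol c r))  ≡⟨ per-Hcol-scaled m p per-H≤ 1ᴳ c ⟩
    1ᴳ ⊗ fromℕᴳ (convolution m c p)                   ≡⟨ ⊗-identityˡ _ ⟩
    fromℕᴳ (convolution m c p)                        ∎

  per-H : 1 ≤ k → ∀ n → per n (Hmat n) ≡ fromℕᴳ (a¹ n)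
  per-H 1≤k = <-rec (λ n → per n (Hmat n) ≡ fromℕᴳ (a¹ n)) step
    where
    step : ∀ n → (∀ {t} → t < n → per t (Hmat t) ≡ fromℕᴳ (a¹ t)) → per n (Hmat n) ≡ fromℕᴳ (a¹ n)
    step zero    _   = cong fromℕᴳ (sym (past₀-one refl 1≤k))
    step (suc m) rec = begin
      per (suc m) (Hmat (suc m))
        ≡⟨ per-cong (suc m) (Hmat (suc m)) (Hcol (suc m) (ιcol cH)) (λ r → λ { zero → refl ; (suc _) → refl }) ⟩
      per (suc m) (Hcol (suc m) (ιcol cH))  ≡⟨ per-Hcol m a¹ (λ t t≤m → rec (s≤s t≤m)) cH ⟩
      fromℕᴳ (convolution m cH a¹)          ≡⟨ cong fromℕᴳ (convolution-cH 1≤k m) ⟩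
      fromℕᴳ (a¹ (suc m))                   ∎

theorem1p20 : (k i lam n : ℕ) → 2 ≤ k → 2 ≤ i → i ≤ k → 1 ≤ lam → 3 ≤ n →
              per n (Hi k lam i n) ≡ fromℕᴳ (a k lam i n)
theorem1p20 k i lam zero    _   _   _   _ ()
theorem1p20 k i lam (suc m) 2≤k 2≤i i≤k _ _ = begin
  per (suc m) (Hi k lam i (suc m))                     ≡⟨ per-cong (suc m) _ _ (Hi≡Hcol k lam i≤k m) ⟩
  per (suc m) (Hcol k lam (suc m) (ιcol (cI k lam i)))
    ≡⟨ per-Hcol k lam m (a¹ k lam) (λ t _ → per-H k lam 1≤k t) (cI k lam i) ⟩
  fromℕᴳ (convolution m (cI k lam i) (a¹ k lam))       ≡⟨ cong fromℕᴳ (convolution-cI k lam 2≤i i≤k m) ⟩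
  fromℕᴳ (a k lam i (suc m))                           ∎
  where
  1≤k : 1 ≤ k
  1≤k = ≤-trans (s≤s z≤n) 2≤k
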